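{- Let $n,p>0$ be integers, let $\mathbf{A}=\mathbf{A}^{p+1}_{n+1}$ be as in the context, and let $t_{np}(x)=(n+1).x^{\max\{n+1,p\}}$. Then: (a) for every $a\in A$, $t_{np}(a)\vee\sim t_{np}(a)=\top$ (i.e. $t_{np}$ is a Boolean term for $\mathbf{A}$); (b) $\mathrm{Rad}(\mathbf{A})=\{a\in A: t_{np}(a)=\top\}=\{a\in A:\ (n+1).a^{k}=\top\text{ for every }k>0\}$; (c) for every $k>0$ and every $a\in A$, $(n+1).\big(a\vee\sim(a^p)\big)^k=\top$.
   Context: Fix integers $n,p>0$. On $\mathbb{Z}\times\mathbb{Z}$ use componentwise addition/subtraction and the lexicographic total order $\preccurlyeq$: $(m,r)\preccurlyeq(k,s)$ iff $m<k$, or $m=k$ and $r\le s$; $\max,\min$ are taken with respect to $\preccurlyeq$. For an integer $j\ge 0$ let $L^\omega_{j+1}=\{(m,r)\in\mathbb{Z}^2:(0,0)\preccurlyeq(m,r)\preccurlyeq(j,0)\}$. On $L^\omega_{n+1}$ put $x*y=\max\{(0,0),x+y-(n,0)\}$ and $x\to y=\min\{(n,0),(n,0)-x+y\}$. Let $L_{p+1}=\{0,1,\dots,p\}$ with the usual order and $\alpha*\beta=\max\{0,\alpha+\beta-p\}$. Let $A=A^{p+1}_{n+1}=(L^\omega_{n+1}\times\{0,p\})\cup(L^\omega_{n}\times\{1,\dots,p-1\})$, with elements written $\langle(m,r),\alpha\rangle$; $\bot=\langle(n,0),0\rangle$, $\top=\langle(n,0),p\rangle$. Define $\langle(m,r),\alpha\rangle\le\langle(k,s),\beta\rangle$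 iff either (o1) $0<\alpha\le\beta$ and $(m,r)\preccurlyeq(k,s)$; or (o2) $\alpha=\beta=0$ and $(k,s)\preccurlyeq(m,r)$; or (o3) $\alpha=0<\beta$ and $(n-1,0)\preccurlyeq(m+k,r+s)$; $\vee$ is the join. Define the commutative operation $\odot$ on $A$, for $a=\langle(m,r),\alpha\rangle$, $b=\langle(k,s),\beta\rangle$: (i) if $\alpha,\beta>0$ and $\alpha*\beta\neq0$: $a\odot b=\langle(m,r)*(k,s),\alpha*\beta\rangle$; (ii) if $\alpha,\beta>0$ and $\alpha*\beta=0$: $a\odot b=\langle\min\{(n,0),(2n-(m+k+1),-(r+s))\},0\rangle$; (iii) if $\alpha>0$, $\beta=0$: $a\odot b=b\odot a=\langle(m,r)\to(k,s),0\rangle$; (iv) if $\alpha=\beta=0$: $a\odot b=\langle\min\{(n,0),(m+k+1,r+s)\},0\rangle$. Define $\sim\langle(m,r),\alpha\rangle=\langle(m,r),p-\alpha\rangle$ if $\alpha\in\{0,p\}$, and $=\langle(n-1-m,-r),p-\alpha\rangle$ otherwise; $x\multimap y=\sim(x\odot\sim y)$ (so $\sim x=x\multimap\bot$); $\mathbf{A}=\langle A;\odot,\multimap,\wedge,\vee,\bot,\top\rangle$. Powers: $a^0=\top$, $a^{k+1}=a\odot a^k$. Multiples: $x\oplus y=\sim(\sim x\odot\sim y)$, $0.x=\bot$, $(k+1).x=x\oplus k.x$. An implicative filter is a subset $F\subseteq A$ with $\top\in F$, closed under $\odot$, and upward closed; $\mathrm{Rad}(\mathbf{A})$ is the intersection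 of all maximal proper implicative filters. -}

module Defs where

open import Data.Nat as ℕ using (ℕ; zero; suc; _∸_; _⊔_)
open import Data.Integer as ℤ using (ℤ; +_; -_)
import Data.Integer.Properties as ℤP
import Data.Nat.Properties as ℕP
open import Data.Product using (_×_; _,_; Σ)
open import Data.Sum using (_⊎_)
open import Relation.Nullary using (Dec; yes; no; ¬_)
open import Relation.Nullary.Decidable using (_⊎-dec_; _×-dec_)
open import Relation.Binary.PropositionalEquality using (_≡_)
open import Level using (Level)

ZZ : Set
ZZ = ℤ × ℤ

infixl 6 _+Z_ _-Z_
_+Z_ : ZZ → ZZ → ZZ
(m , r) +Z (k , s) = (m ℤ.+ k , r ℤ.+ s)

_-Z_ : ZZ → ZZ → ZZ
(m , r) -Z (k , s) = (m ℤ.- k , r ℤ.- s)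

_≼_ : ZZ → ZZ → Set
(m , r) ≼ (k , s) = (m ℤ.< k) ⊎ ((m ≡ k) × (r ℤ.≤ s))

_≼?_ : (x y : ZZ) → Dec (x ≼ y)
(m , r) ≼? (k , s) = (m ℤP.<? k) ⊎-dec ((m ℤP.≟ k) ×-dec (r ℤP.≤? s))

maxZ : ZZ → ZZ → ZZ
maxZ x y with x ≼? y
... | yes _ = y
... | no  _ = x

minZ : ZZ → ZZ → ZZ
minZ x y with x ≼? y
... | yes _ = x
... | no  _ = y

-- L^ω_{j+1} = {(m,r) : (0,0) ≼ (m,r) ≼ (j,0)}
Lω : ℤ → ZZ → Set
Lω j x = ((+ 0 , + 0) ≼ x) × (x ≼ (j , + 0))

Raw : Set
Raw = ZZ × ℕ

nZ : ℕ → ZZ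
nZ n = (+ n , + 0)

InA : ℕ → ℕ → Raw → Set
InA n p (x , α) =
  (((α ≡ 0) ⊎ (α ≡ p)) × Lω (+ n) x)
  ⊎ ((0 ℕ.< α) × (α ℕ.< p) × Lω (+ n ℤ.- + 1) x)

top : ℕ → ℕ → Raw
top n p = (nZ n , p)

bot : ℕ → ℕ → Raw
bot n p = (nZ n , 0)

mulL : ℕ → ZZ → ZZ → ZZ
mulL n x y = maxZ (+ 0 , + 0) ((x +Z y) -Z nZ n)

impL : ℕ → ZZ → ZZ → ZZ
impL n x y = minZ (nZ n) ((nZ n -Z x) +Z y)

mulLp : ℕ → ℕ → ℕ → ℕ
mulLp p α β = (α ℕ.+ β) ∸ p

mul : ℕ → ℕ → Raw → Raw → Raw
mul n p ((m , r) , zero) ((k , s) , zero) =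
  (minZ (nZ n) (m ℤ.+ k ℤ.+ + 1 , r ℤ.+ s) , 0)
mul n p (x , zero) (y , suc β) = (impL n y x , 0)
mul n p (x , suc α) (y , zero) = (impL n x y , 0)
mul n p ((m , r) , suc α) ((k , s) , suc β) with mulLp p (suc α) (suc β)
... | zero  = (minZ (nZ n) (+ 2 ℤ.* + n ℤ.- (m ℤ.+ k ℤ.+ + 1) , - (r ℤ.+ s)) , 0)
... | suc γ = (mulL n (m , r) (k , s) , suc γ)

neg : ℕ → ℕ → Raw → Raw
neg n p (x , zero) = (x , p)
neg n p ((m , r) , suc α) with suc α ℕP.≟ p
... | yes _ = ((m , r) , 0)
... | no  _ = ((+ n ℤ.- + 1 ℤ.- m , - r) , p ∸ suc α)

res : ℕ → ℕ → Raw → Raw → Raw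
res n p x y = neg n p (mul n p x (neg n p y))

oplus : ℕ → ℕ → Raw → Raw → Raw
oplus n p x y = neg n p (mul n p (neg n p x) (neg n p y))

pow : ℕ → ℕ → Raw → ℕ → Raw
pow n p a zero    = top n p
pow n p a (suc k) = mul n p a (pow n p a k)

mult : ℕ → ℕ → ℕ → Raw → Raw
mult n p zero    x = bot n p
mult n p (suc k) x = oplus n p x (mult n p k x)

t : ℕ → ℕ → Raw → Raw
t n p x = mult n p (suc n) (pow n p x (suc n ⊔ p))

Leq : ℕ → ℕ → Raw → Raw → Set
Leq n p ((m , r) , α) ((k , s) , β) =
    ((0 ℕ.< α) × (α ℕ.≤ β) × ((m , r) ≼ (k , s)))
  ⊎ ((α ≡ 0) × (β ≡ 0) × ((k , s) ≼ (m , r)))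
  ⊎ ((α ≡ 0) × (0 ℕ.< β) × ((+ n ℤ.- + 1 , + 0) ≼ (m ℤ.+ k , r ℤ.+ s)))

IsJoin : ℕ → ℕ → Raw → Raw → Raw → Set
IsJoin n p x y j =
  InA n p j × Leq n p x j × Leq n p y j
  × ((z : Raw) → InA n p z → Leq n p x z → Leq n p y z → Leq n p j z)

Subset : Set₁
Subset = Raw → Set

IsImplFilter : ℕ → ℕ → Subset → Set
IsImplFilter n p F =
  ((x : Raw) → F x → InA n p x)
  × F (top n p)
  × ((x y : Raw) → F x → F y → F (mul n p x y))
  × ((x y : Raw) → InA n p y → F x → Leq n p x y → F y)

IsProper : ℕ → ℕ → Subset → Set
IsProper n p F = ¬ ((x : Raw) → InA n p x → F x)

IsMaximalFilter : ℕ → ℕ → Subset → Set₁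
IsMaximalFilter n p F =
  IsImplFilter n p F × IsProper n p F
  × ((G : Subset) → IsImplFilter n p G → IsProper n p G
       → ((x : Raw) → F x → G x) → (x : Raw) → G x → F x)

InRad : ℕ → ℕ → Raw → Set₁
InRad n p a = (F : Subset) → IsMaximalFilter n p F → F a

-- The elements of A with label p form the positive cone P ≅ L^ω_{n+1}, on which ⊙ is
-- truncated addition; so P is closed under ⊙ and every (n+1)-fold multiple of an element
-- of P is ⊤.  For any other a ∈ A the powers a^j first keep a positive label, which drops
-- with j (so for fewer than p steps) while the coordinate shrinks; once the label is 0,
-- each further factor a raises the coordinate by at least (1,0).  Hence a^{max{n+1,p}} = ⊥,
-- t_{np} is ⊤ on P and ⊥ off P, and P is the unique maximal implicative filter, as a proper
-- filter cannot contain an element with a power ⊥.  Finally a ∨ ∼(a^p) lies above a or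
-- above ∼(a^p), one of which is in P.
module Submission where

open import Defs
open import Data.Nat as ℕ using (ℕ; zero; suc; _⊔_; z≤n; s≤s; _<_; _≤_)
import Data.Nat.Properties as ℕP
open import Data.Integer as ℤ using (+_; -_; +<+)
import Data.Integer.Properties as ℤP
open import Data.Integer.Tactic.RingSolver using (solve-∀)
open import Data.Product using (_×_; _,_; Σ; proj₁; proj₂)
open import Data.Product.Relation.Binary.Lex.Strict using (×-transitive; ×-antisymmetric; ×-total₂)
open import Data.Product.Relation.Binary.Pointwise.NonDependent using (≡×≡⇒≡)
open import Data.Sum using (_⊎_; inj₁; inj₂)
open import Data.Empty using (⊥-elim)
open import Function.Bundles using (Equivalence; _⇔_; mk⇔)
open import Function.Construct.Composition using (_⇔-∘_)
open import Relation.Nullary using (yes; no; ¬_)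
open import Relation.Binary.Bundles using (Preorder)
open import Relation.Binary.Definitions using (Transitive; Antisymmetric; Total)
import Relation.Binary.Reasoning.Preorder
open import Relation.Binary.PropositionalEquality

-- The ordered group ℤ × ℤ

zeroZ oneZ : ZZ
zeroZ = (+ 0 , + 0)
oneZ = (+ 1 , + 0)

x+y-x≡y : ∀ x y → x +Z y -Z x ≡ y
x+y-x≡y (a , b) (c , d) = cong₂ _,_ (lemma a c) (lemma b d)
  where lemma : ∀ a c → a ℤ.+ c ℤ.- a ≡ c
        lemma = solve-∀

x-x+y≡y : ∀ x y → x -Z x +Z y ≡ y
x-x+y≡y (a , b) (c , d) = cong₂ _,_ (lemma a c) (lemma b d)
  where lemma : ∀ a c → a ℤ.- a ℤ.+ c ≡ c
        lemma = solve-∀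

x+[y-x]≡y : ∀ x y → x +Z (y -Z x) ≡ y
x+[y-x]≡y (a , b) (c , d) = cong₂ _,_ (lemma a c) (lemma b d)
  where lemma : ∀ a c → a ℤ.+ (c ℤ.- a) ≡ c
        lemma = solve-∀

x+[y+z]≡[y+x]+z : ∀ x y z → x +Z (y +Z z) ≡ (y +Z x) +Z z
x+[y+z]≡[y+x]+z (a , b) (c , d) (e , f) = cong₂ _,_ (lemma a c e) (lemma b d f)
  where lemma : ∀ a c e → a ℤ.+ (c ℤ.+ e) ≡ c ℤ.+ a ℤ.+ e
        lemma = solve-∀

x+zeroZ≡x : ∀ x → x +Z zeroZ ≡ x
x+zeroZ≡x (a , b) = cong₂ _,_ (ℤP.+-identityʳ a) (ℤP.+-identityʳ b)

zeroZ+x≡x : ∀ x → zeroZ +Z x ≡ x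
zeroZ+x≡x (a , b) = cong₂ _,_ (ℤP.+-identityˡ a) (ℤP.+-identityˡ b)

≼-refl : ∀ x → x ≼ x
≼-refl _ = inj₂ (refl , ℤP.≤-refl)

≼-reflexive : ∀ {x y} → x ≡ y → x ≼ y
≼-reflexive refl = ≼-refl _

≼-trans : Transitive _≼_
≼-trans = ×-transitive {_≈₁_ = _≡_} {_<₁_ = ℤ._<_} {_<₂_ = ℤ._≤_}
  isEquivalence (resp₂ ℤ._<_) ℤP.<-trans ℤP.≤-trans

≼-antisym : Antisymmetric _≡_ _≼_
≼-antisym x≼y y≼x = ≡×≡⇒≡ (×-antisymmetric {_≈₁_ = _≡_} {_<₁_ = ℤ._<_} {_<₂_ = ℤ._≤_}
  sym (λ { refl → ℤP.<-irrefl refl }) ℤP.<-asym ℤP.≤-antisym x≼y y≼x)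

≼-total : Total _≼_
≼-total = ×-total₂ {_≈₁_ = _≡_} {_<₁_ = ℤ._<_} {_<₂_ = ℤ._≤_} sym ℤP.<-cmp ℤP.≤-total

≼-preorder : Preorder _ _ _
≼-preorder = record
  { _≈_ = _≡_
  ; _≲_ = _≼_
  ; isPreorder = record { isEquivalence = isEquivalence ; reflexive = ≼-reflexive ; trans = ≼-trans }
  }

module ≼-Reasoning = Relation.Binary.Reasoning.Preorder ≼-preorder

⋠⇒≽ : ∀ {x y} → ¬ (x ≼ y) → y ≼ x
⋠⇒≽ {x} {y} x⋠y with ≼-total x y
... | inj₁ x≼y = ⊥-elim (x⋠y x≼y)
... | inj₂ y≼x = y≼x

≼-ℕ : ∀ {j k} → j ≤ k → (+ j , + 0) ≼ (+ k , + 0)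
≼-ℕ j≤k with ℕP.m≤n⇒m<n∨m≡n j≤k
... | inj₁ j<k = inj₁ (+<+ j<k)
... | inj₂ refl = ≼-refl _

+Z-mono-≼ : ∀ {x y z w} → x ≼ y → z ≼ w → (x +Z z) ≼ (y +Z w)
+Z-mono-≼ {_ , _} {_ , _} {e , _} {_ , _} (inj₁ a<c) (inj₁ e<g) = inj₁ (ℤP.+-mono-< a<c e<g)
+Z-mono-≼ {_ , _} {_ , _} {e , _} {_ , _} (inj₁ a<c) (inj₂ (refl , _)) = inj₁ (ℤP.+-monoˡ-< e a<c)
+Z-mono-≼ {a , _} {_ , _} {_ , _} {_ , _} (inj₂ (refl , _)) (inj₁ e<g) = inj₁ (ℤP.+-monoʳ-< a e<g)
+Z-mono-≼ {_ , _} {_ , _} {_ , _} {_ , _} (inj₂ (refl , b≤d)) (inj₂ (refl , f≤h)) =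
  inj₂ (refl , ℤP.+-mono-≤ b≤d f≤h)

+Z-monoʳ-≼ : ∀ z {x y} → x ≼ y → (z +Z x) ≼ (z +Z y)
+Z-monoʳ-≼ z = +Z-mono-≼ (≼-refl z)

+Z-monoˡ-≼ : ∀ z {x y} → x ≼ y → (x +Z z) ≼ (y +Z z)
+Z-monoˡ-≼ z x≼y = +Z-mono-≼ x≼y (≼-refl z)

-Z-mono-≼ : ∀ {x y z w} → x ≼ y → w ≼ z → (x -Z z) ≼ (y -Z w)
-Z-mono-≼ {z = _ , _} {_ , _} x≼y w≼z = +Z-mono-≼ x≼y (neg-antimono w≼z)
  where
  neg-antimono : ∀ {a b c d} → (a , b) ≼ (c , d) → (- c , - d) ≼ (- a , - b)
  neg-antimono (inj₁ a<c) = inj₁ (ℤP.neg-mono-< a<c)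
  neg-antimono (inj₂ (refl , b≤d)) = inj₂ (refl , ℤP.neg-mono-≤ b≤d)

+Z-cancelˡ-≼ : ∀ z {x y} → (z +Z x) ≼ (z +Z y) → x ≼ y
+Z-cancelˡ-≼ z {x} {y} h = subst₂ _≼_ (x+y-x≡y z x) (x+y-x≡y z y) (-Z-mono-≼ h (≼-refl z))

x≼x+y : ∀ x {y} → zeroZ ≼ y → x ≼ (x +Z y)
x≼x+y x {y} 0≼y = subst (_≼ (x +Z y)) (x+zeroZ≡x x) (+Z-monoʳ-≼ x 0≼y)

x≼y+x : ∀ x {y} → zeroZ ≼ y → x ≼ (y +Z x)
x≼y+x x {y} 0≼y = subst (_≼ (y +Z x)) (zeroZ+x≡x x) (+Z-monoˡ-≼ x 0≼y)

x+y≼z⇒y≼z-x : ∀ x y {z} → (x +Z y) ≼ z → y ≼ (z -Z x)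
x+y≼z⇒y≼z-x x y {z} h = subst (_≼ (z -Z x)) (x+y-x≡y x y) (-Z-mono-≼ h (≼-refl x))

z≼x+y⇒z-x≼y : ∀ x y {z} → z ≼ (x +Z y) → (z -Z x) ≼ y
z≼x+y⇒z-x≼y x y {z} h = subst ((z -Z x) ≼_) (x+y-x≡y x y) (-Z-mono-≼ h (≼-refl x))

clause-iv : ZZ → ZZ → ZZ
clause-iv (m , r) (k , s) = (m ℤ.+ k ℤ.+ + 1 , r ℤ.+ s)

oneZ+y≼clause-iv : ∀ {x} y → zeroZ ≼ x → (oneZ +Z y) ≼ clause-iv x y
oneZ+y≼clause-iv {a , b} (c , d) 0≼x =
  subst ((oneZ +Z (c , d)) ≼_) (cong₂ _,_ (lemma₁ a c) (lemma₀ b d)) (x≼x+y (oneZ +Z (c , d)) 0≼x)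
  where lemma₁ : ∀ a c → + 1 ℤ.+ c ℤ.+ a ≡ a ℤ.+ c ℤ.+ + 1
        lemma₁ = solve-∀
        lemma₀ : ∀ b d → + 0 ℤ.+ d ℤ.+ b ≡ b ℤ.+ d
        lemma₀ = solve-∀

minZ-≼ˡ : ∀ x y → minZ x y ≼ x
minZ-≼ˡ x y with x ≼? y
... | yes _ = ≼-refl x
... | no x⋠y = ⋠⇒≽ x⋠y

minZ-greatest : ∀ {z x y} → z ≼ x → z ≼ y → z ≼ minZ x y
minZ-greatest {x = x} {y} z≼x z≼y with x ≼? y
... | yes _ = z≼x
... | no _ = z≼y

x≼y⇒minZ≡x : ∀ {x y} → x ≼ y → minZ x y ≡ x
x≼y⇒minZ≡x {x} {y} x≼y with x ≼? y
... | yes _ = refl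
... | no x⋠y = ⊥-elim (x⋠y x≼y)

minZ-sel : ∀ x y → minZ x y ≡ x ⊎ minZ x y ≡ y
minZ-sel x y with x ≼? y
... | yes _ = inj₁ refl
... | no _ = inj₂ refl

maxZ-≼ˡ : ∀ x y → x ≼ maxZ x y
maxZ-≼ˡ x y with x ≼? y
... | yes x≼y = x≼y
... | no _ = ≼-refl x

maxZ-≼ʳ : ∀ x y → y ≼ maxZ x y
maxZ-≼ʳ x y with x ≼? y
... | yes _ = ≼-refl y
... | no x⋠y = ⋠⇒≽ x⋠y

maxZ-least : ∀ {z x y} → x ≼ z → y ≼ z → maxZ x y ≼ z
maxZ-least {x = x} {y} x≼z y≼z with x ≼? y
... | yes _ = y≼z
... | no _ = x≼z

y≼x⇒maxZ≡x : ∀ {x y} → y ≼ x → maxZ x y ≡ x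
y≼x⇒maxZ≡x {x} {y} y≼x with x ≼? y
... | yes x≼y = ≼-antisym y≼x x≼y
... | no _ = refl

x≼y⇒maxZ≡y : ∀ {x y} → x ≼ y → maxZ x y ≡ y
x≼y⇒maxZ≡y {x} {y} x≼y with x ≼? y
... | yes _ = refl
... | no x⋠y = ⊥-elim (x⋠y x≼y)

maxZ-sel : ∀ x y → maxZ x y ≡ x ⊎ maxZ x y ≡ y
maxZ-sel x y with x ≼? y
... | yes _ = inj₂ refl
... | no _ = inj₁ refl

mulLp-< : ∀ {p α} β → α < p → mulLp p α (suc β) < suc β
mulLp-< {p} {α} β α<p = ℕP.m<n+o⇒m∸n<o (α ℕ.+ suc β) p (ℕP.+-monoˡ-< (suc β) α<p)

module _ (n p' : ℕ) where

  p : ℕ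
  p = suc p'

  N : ZZ
  N = nZ n

  predN : ZZ
  predN = (+ n ℤ.- + 1 , + 0)

  zeroZ≼N : zeroZ ≼ N
  zeroZ≼N = ≼-ℕ z≤n

  N≼oneZ+N : N ≼ (oneZ +Z N)
  N≼oneZ+N = x≼y+x N (≼-ℕ z≤n)

  predN+oneZ≡N : predN +Z oneZ ≡ N
  predN+oneZ≡N = cong (λ m → (m , + 0)) (lemma (+ n))
    where lemma : ∀ m → m ℤ.- + 1 ℤ.+ + 1 ≡ m
          lemma = solve-∀

  neg-label-p : ∀ x → neg n p (x , p) ≡ (x , 0)
  neg-label-p _ with p ℕP.≟ p
  ... | yes _ = refl
  ... | no p≢p = ⊥-elim (p≢p refl)

  predN≼N : predN ≼ N
  predN≼N = ≼-trans (x≼x+y predN (≼-ℕ z≤n)) (≼-reflexive predN+oneZ≡N)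

  InA⇒Lω : ∀ {x α} → InA n p (x , α) → Lω (+ n) x
  InA⇒Lω (inj₁ (_ , x∈L)) = x∈L
  InA⇒Lω (inj₂ (_ , _ , 0≼x , x≼predN)) = 0≼x , ≼-trans x≼predN predN≼N

  bot∈A : InA n p (bot n p)
  bot∈A = inj₁ (inj₁ refl , zeroZ≼N , ≼-refl N)

  InA⇒label≤p : ∀ {x α} → InA n p (x , α) → α ≤ p
  InA⇒label≤p (inj₁ (inj₁ refl , _)) = z≤n
  InA⇒label≤p (inj₁ (inj₂ refl , _)) = ℕP.≤-refl
  InA⇒label≤p (inj₂ (_ , α<p , _)) = ℕP.<⇒≤ α<p

  clause-ii : ZZ → ZZ → ZZ
  clause-ii (m , r) (k , s) = (+ 2 ℤ.* + n ℤ.- (m ℤ.+ k ℤ.+ + 1) , - (r ℤ.+ s))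

  data PositiveProduct (x y : ZZ) (c : ℕ) : Raw → Set where
    cancels  : c ≡ 0 →
      PositiveProduct x y c (minZ N (clause-ii x y) , 0)
    survives : ∀ {γ} → c ≡ suc γ → PositiveProduct x y c (mulL n x y , suc γ)

  positiveProduct : ∀ x y α β →
    PositiveProduct x y (mulLp p (suc α) (suc β)) (mul n p (x , suc α) (y , suc β))
  positiveProduct (_ , _) (_ , _) α β with mulLp p (suc α) (suc β)
  ... | zero = cancels refl
  ... | suc _ = survives refl

-- The positive cone

  Positive : Raw → Set
  Positive a = Σ ZZ λ x → a ≡ (x , p) × Lω (+ n) x

  Positive⇒InA : ∀ {a} → Positive a → InA n p a
  Positive⇒InA (_ , refl , x∈L) = inj₁ (inj₂ refl , x∈L)

  top-Positive : Positive (top n p)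
  top-Positive = N , refl , zeroZ≼N , ≼-refl N

  bot-not-Positive : ¬ Positive (bot n p)
  bot-not-Positive (_ , () , _)

  mul-label-p : ∀ x y → mul n p (x , p) (y , p) ≡ (mulL n x y , p)
  mul-label-p x y with mul n p (x , p) (y , p) | positiveProduct x y p' p'
  ... | _ | cancels p∸p≡0 = ⊥-elim (ℕP.1+n≢0 (trans (sym (ℕP.m+n∸n≡m p p)) p∸p≡0))
  ... | _ | survives p∸p≡γ = cong (mulL n x y ,_) (trans (sym p∸p≡γ) (ℕP.m+n∸n≡m p p))

  mulL-Lω : ∀ {x y} → Lω (+ n) x → Lω (+ n) y → Lω (+ n) (mulL n x y)
  mulL-Lω {x} {y} (_ , x≼N) (_ , y≼N) =
    maxZ-≼ˡ zeroZ (x +Z y -Z N) ,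
    maxZ-least zeroZ≼N (z≼x+y⇒z-x≼y N N (+Z-mono-≼ x≼N y≼N))

  Positive-mul : ∀ {a b} → Positive a → Positive b → Positive (mul n p a b)
  Positive-mul (x , refl , x∈L) (y , refl , y∈L) = mulL n x y , mul-label-p x y , mulL-Lω x∈L y∈L

  Positive-pow : ∀ {a} → Positive a → ∀ k → Positive (pow n p a k)
  Positive-pow a∈P zero = top-Positive
  Positive-pow a∈P (suc k) = Positive-mul a∈P (Positive-pow a∈P k)

  Positive-upward : ∀ {a b} → Positive a → InA n p b → Leq n p a b → Positive b
  Positive-upward (_ , refl , _) b∈A (inj₁ (_ , p≤β , _)) =
    _ , cong (_ ,_) (ℕP.≤-antisym (InA⇒label≤p b∈A) p≤β) , InA⇒Lω b∈A
  Positive-upward (_ , refl , _) _ (inj₂ (inj₁ (() , _)))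
  Positive-upward (_ , refl , _) _ (inj₂ (inj₂ (() , _)))

  -- ⟨y,p⟩ ⊕ ⟨u,p⟩ = ⟨min{(n,0), y+u+(1,0)}, p⟩, so each summand adds at least (1,0).
  mult-label-p : ∀ {y} → zeroZ ≼ y → ∀ k → k ≤ n →
    Σ ZZ λ u → mult n p (suc k) (y , p) ≡ (u , p) × (+ k , + 0) ≼ u × u ≼ N
  mult-label-p {y} 0≼y zero _ =
    impL n N y , cong (λ c → neg n p (mul n p c (top n p))) (neg-label-p y) ,
    minZ-greatest zeroZ≼N (subst (zeroZ ≼_) (sym (x-x+y≡y N y)) 0≼y) ,
    minZ-≼ˡ N (N -Z N +Z y)
  mult-label-p {y} 0≼y (suc k) 1+k≤n with mult-label-p 0≼y k (ℕP.<⇒≤ 1+k≤n)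
  ... | u , mult≡u , k≼u , _ =
    minZ N (clause-iv y u) ,
    cong₂ (λ c d → neg n p (mul n p c d)) (neg-label-p y) (trans (cong (neg n p) mult≡u) (neg-label-p u)) ,
    minZ-greatest (≼-ℕ 1+k≤n) (≼-trans (+Z-monoʳ-≼ oneZ k≼u) (oneZ+y≼clause-iv u 0≼y)) ,
    minZ-≼ˡ N (clause-iv y u)

  mult-Positive : ∀ {a} → Positive a → mult n p (suc n) a ≡ top n p
  mult-Positive (y , refl , 0≼y , _) with mult-label-p 0≼y n ℕP.≤-refl
  ... | u , mult≡u , N≼u , u≼N = trans mult≡u (cong (_, p) (≼-antisym u≼N N≼u))

  mult-pow-Positive : ∀ {a} → Positive a → ∀ k → mult n p (suc n) (pow n p a k) ≡ top n p
  mult-pow-Positive a∈P k = mult-Positive (Positive-pow a∈P k)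

  mult-bot : ∀ k → mult n p k (bot n p) ≡ bot n p
  mult-bot zero = refl
  mult-bot (suc k) = begin
    neg n p (mul n p (top n p) (neg n p (mult n p k (bot n p))))
      ≡⟨ cong (λ b → neg n p (mul n p (top n p) (neg n p b))) (mult-bot k) ⟩
    neg n p (mul n p (top n p) (top n p))  ≡⟨ cong (neg n p) (mul-label-p N N) ⟩
    neg n p (mulL n N N , p)               ≡⟨ neg-label-p (mulL n N N) ⟩
    (mulL n N N , 0)                       ≡⟨ cong (_, 0) mulL-N-N ⟩
    bot n p                                ∎
    where
    open ≡-Reasoning
    mulL-N-N : mulL n N N ≡ N
    mulL-N-N = trans (x≼y⇒maxZ≡y (subst (zeroZ ≼_) (sym (x+y-x≡y N N)) zeroZ≼N)) (x+y-x≡y N N)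

-- Powers outside the positive cone

  data NonPositive : Raw → Set where
    label-zero : ∀ {x} → zeroZ ≼ x → NonPositive (x , 0)
    label-mid  : ∀ {x α} → suc α < p → (x +Z oneZ) ≼ N → NonPositive (x , suc α)

  InA-split : ∀ {a} → InA n p a → Positive a ⊎ NonPositive a
  InA-split {x , α} a∈A with α ℕP.≟ p
  ... | yes refl = inj₁ (x , refl , InA⇒Lω a∈A)
  InA-split {x , zero} a∈A | no _ = inj₂ (label-zero (proj₁ (InA⇒Lω a∈A)))
  InA-split {x , suc α} (inj₁ (inj₁ () , _)) | no _
  InA-split {x , suc α} (inj₁ (inj₂ α≡p , _)) | no α≢p = ⊥-elim (α≢p α≡p)
  InA-split {x , suc α} (inj₂ (_ , α<p , _ , x≼predN)) | no _ =
    inj₂ (label-mid α<p (≼-trans (+Z-monoˡ-≼ oneZ x≼predN) (≼-reflexive predN+oneZ≡N)))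

  Below : ℕ → ZZ → Set
  Below j x = x ≡ zeroZ ⊎ (x +Z (+ j , + 0)) ≼ N

  Above : ℕ → ZZ → Set
  Above j w = w ≡ N ⊎ (+ j , + 0) ≼ (oneZ +Z w)

  PosDepth : ℕ → Raw → Set
  PosDepth j b = Σ ZZ λ x → Σ ℕ λ γ → b ≡ (x , suc γ) × j ℕ.+ suc γ ≤ p × Below j x

  ZeroDepth : ℕ → Raw → Set
  ZeroDepth j b = Σ ZZ λ w → b ≡ (w , 0) × w ≼ N × Above j w

  ZeroDepth-minZ : ∀ {j v} → N ≼ v ⊎ (+ j , + 0) ≼ v → ZeroDepth (suc j) (minZ N v , 0)
  ZeroDepth-minZ {j} {v} h = minZ N v , refl , minZ-≼ˡ N v , above h
    where
    above : N ≼ v ⊎ (+ j , + 0) ≼ v → Above (suc j) (minZ N v)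
    above (inj₁ N≼v) = inj₁ (x≼y⇒minZ≡x N≼v)
    above (inj₂ j≼v) with minZ-sel N v
    ... | inj₁ min≡N = inj₁ min≡N
    ... | inj₂ min≡v = inj₂ (subst (λ m → (+ suc j , + 0) ≼ (oneZ +Z m)) (sym min≡v) (+Z-monoʳ-≼ oneZ j≼v))

  mul-label-zero : ∀ {a} → NonPositive a → ∀ w →
    Σ ZZ λ v → mul n p a (w , 0) ≡ (minZ N v , 0) × (oneZ +Z w) ≼ v
  mul-label-zero (label-zero {x} 0≼x) w =
    clause-iv x w , refl , oneZ+y≼clause-iv w 0≼x
  mul-label-zero (label-mid {x} _ x+1≼N) w =
    (N -Z x) +Z w , refl , +Z-monoˡ-≼ w (x+y≼z⇒y≼z-x x oneZ x+1≼N)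

  ZeroDepth-step : ∀ {a j b} → NonPositive a → ZeroDepth j b → ZeroDepth (suc j) (mul n p a b)
  ZeroDepth-step {j = j} a∉P (w , refl , _ , w-above) with mul-label-zero a∉P w
  ... | v , ab≡ , 1+w≼v = subst (ZeroDepth (suc j)) (sym ab≡) (ZeroDepth-minZ (bound w-above))
    where
    bound : Above j w → N ≼ v ⊎ (+ j , + 0) ≼ v
    bound (inj₁ refl) = inj₁ (≼-trans N≼oneZ+N 1+w≼v)
    bound (inj₂ j≼1+w) = inj₂ (≼-trans j≼1+w 1+w≼v)

  Below⇒ZeroDepth : ∀ {j x v} → Below j x → (N -Z x) ≼ v → ZeroDepth (suc j) (minZ N v , 0)
  Below⇒ZeroDepth (inj₁ refl) N≼v = ZeroDepth-minZ (inj₁ (≼-trans (≼-reflexive (sym (x+zeroZ≡x N))) N≼v))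
  Below⇒ZeroDepth {j} {x} (inj₂ x+j≼N) N-x≼v =
    ZeroDepth-minZ (inj₂ (≼-trans (x+y≼z⇒y≼z-x x (+ j , + 0) x+j≼N) N-x≼v))

  -- x +Z x' -Z N is mulL n x x' before truncation at (0,0).
  mulL-lowers : ∀ x x' → (x +Z oneZ) ≼ N → (oneZ +Z (x +Z x' -Z N)) ≼ x'
  mulL-lowers x x' x+1≼N = subst (_≼ x') (shift x x') (z≼x+y⇒z-x≼y N x' (+Z-monoˡ-≼ x' x+1≼N))
    where
    shift : ∀ x x' → x +Z oneZ +Z x' -Z N ≡ oneZ +Z (x +Z x' -Z N)
    shift (a , b) (c , d) = cong₂ _,_ (lemma a c (+ n) (+ 1)) (lemma b d (+ 0) (+ 0))
      where lemma : ∀ a c m e → a ℤ.+ e ℤ.+ c ℤ.- m ≡ e ℤ.+ (a ℤ.+ c ℤ.- m)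
            lemma = solve-∀

  mulL-Below : ∀ {j} x {x'} → (x +Z oneZ) ≼ N → Below j x' → Below (suc j) (mulL n x x')
  mulL-Below {j} x {x'} x+1≼N x'-below with x'-below | maxZ-sel zeroZ (x +Z x' -Z N)
  ... | inj₁ refl | _ =
    inj₁ (y≼x⇒maxZ≡x (≼-trans (x≼y+x (x +Z x' -Z N) (≼-ℕ z≤n)) (mulL-lowers x x' x+1≼N)))
  ... | inj₂ _ | inj₁ max≡0 = inj₁ max≡0
  ... | inj₂ x'+j≼N | inj₂ max≡u = inj₂ (subst (λ m → (m +Z (+ suc j , + 0)) ≼ N) (sym max≡u) (begin
    (x +Z x' -Z N) +Z (oneZ +Z (+ j , + 0))  ≡⟨ x+[y+z]≡[y+x]+z (x +Z x' -Z N) oneZ (+ j , + 0) ⟩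
    (oneZ +Z (x +Z x' -Z N)) +Z (+ j , + 0)  ≲⟨ +Z-monoˡ-≼ (+ j , + 0) (mulL-lowers x x' x+1≼N) ⟩
    x' +Z (+ j , + 0)                        ≲⟨ x'+j≼N ⟩
    N                                        ∎))
    where open ≼-Reasoning

  mid-transition : ∀ x x' → (x +Z oneZ) ≼ N →
    (N -Z x') ≼ clause-ii x x'
  mid-transition x x' x+1≼N = subst ((N -Z x') ≼_) (split x x') (x≼x+y (N -Z x') 0≼N-[x+1])
    where
    0≼N-[x+1] : zeroZ ≼ (N -Z (x +Z oneZ))
    0≼N-[x+1] = x+y≼z⇒y≼z-x (x +Z oneZ) zeroZ (≼-trans (≼-reflexive (x+zeroZ≡x (x +Z oneZ))) x+1≼N)
    split : ∀ x x' → (N -Z x') +Z (N -Z (x +Z oneZ)) ≡ clause-ii x x'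
    split (a , b) (c , d) = cong₂ _,_ (lemma₁ a c (+ n)) (lemma₀ b d)
      where lemma₁ : ∀ a c m → m ℤ.- c ℤ.+ (m ℤ.- (a ℤ.+ + 1)) ≡ + 2 ℤ.* m ℤ.- (a ℤ.+ c ℤ.+ + 1)
            lemma₁ = solve-∀
            lemma₀ : ∀ b d → + 0 ℤ.- d ℤ.+ (+ 0 ℤ.- (b ℤ.+ + 0)) ≡ - (b ℤ.+ d)
            lemma₀ = solve-∀

  PosDepth-step : ∀ {a j b} → NonPositive a → PosDepth j b →
    PosDepth (suc j) (mul n p a b) ⊎ ZeroDepth (suc j) (mul n p a b)
  PosDepth-step (label-zero {x} 0≼x) (x' , _ , refl , _ , x'-below) =
    inj₂ (Below⇒ZeroDepth x'-below (x≼x+y (N -Z x') 0≼x))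
  PosDepth-step {j = j} (label-mid {x} {α} α<p x+1≼N) (x' , γ , refl , j+γ≤p , x'-below)
    with mul n p (x , suc α) (x' , suc γ) | positiveProduct x x' α γ
  ... | _ | cancels _ = inj₂ (Below⇒ZeroDepth x'-below (mid-transition x x' x+1≼N))
  ... | _ | survives γ'≡ =
    inj₁ (mulL n x x' , _ , refl ,
          ℕP.≤-trans (ℕP.+-monoʳ-< j (subst (_< suc γ) γ'≡ (mulLp-< γ α<p))) j+γ≤p ,
          mulL-Below x x+1≼N x'-below)

  pow-depth : ∀ {a} → NonPositive a → ∀ j → PosDepth j (pow n p a j) ⊎ ZeroDepth j (pow n p a j)
  pow-depth a∉P zero = inj₁ (N , p' , refl , ℕP.≤-refl , inj₂ (≼-reflexive (x+zeroZ≡x N)))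
  pow-depth a∉P (suc j) with pow-depth a∉P j
  ... | inj₁ depth = PosDepth-step a∉P depth
  ... | inj₂ depth = inj₂ (ZeroDepth-step a∉P depth)

  pow-ZeroDepth : ∀ {a j} → NonPositive a → p ≤ j → ZeroDepth j (pow n p a j)
  pow-ZeroDepth {j = j} a∉P p≤j with pow-depth a∉P j
  ... | inj₁ (_ , _ , _ , j+γ≤p , _) = ⊥-elim (ℕP.m+1+n≰m j (ℕP.≤-trans j+γ≤p p≤j))
  ... | inj₂ depth = depth

  ZeroDepth-bot : ∀ {j b} → n < j → ZeroDepth j b → b ≡ bot n p
  ZeroDepth-bot _ (_ , refl , _ , inj₁ refl) = refl
  ZeroDepth-bot n<j (_ , refl , w≼N , inj₂ j≼1+w) =
    cong (_, 0) (≼-antisym w≼N (+Z-cancelˡ-≼ oneZ (≼-trans (≼-ℕ n<j) j≼1+w)))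

  ZeroDepth-neg-Positive : ∀ {j b} → 0 < j → ZeroDepth j b → Positive (neg n p b)
  ZeroDepth-neg-Positive _ (_ , refl , w≼N , inj₁ refl) = N , refl , zeroZ≼N , w≼N
  ZeroDepth-neg-Positive 0<j (w , refl , w≼N , inj₂ j≼1+w) =
    w , refl , +Z-cancelˡ-≼ oneZ (≼-trans (≼-ℕ 0<j) j≼1+w) , w≼N

  pow-bot : ∀ {a} → NonPositive a → pow n p a (suc n ⊔ p) ≡ bot n p
  pow-bot a∉P = ZeroDepth-bot (ℕP.m≤m⊔n (suc n) p) (pow-ZeroDepth a∉P (ℕP.m≤n⊔m (suc n) p))

  neg-pow-Positive : ∀ {a} → NonPositive a → Positive (neg n p (pow n p a p))
  neg-pow-Positive a∉P = ZeroDepth-neg-Positive (s≤s z≤n) (pow-ZeroDepth a∉P ℕP.≤-refl)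

-- Filters and the radical

  t-Positive : ∀ {a} → Positive a → t n p a ≡ top n p
  t-Positive a∈P = mult-pow-Positive a∈P (suc n ⊔ p)

  t-NonPositive : ∀ {a} → NonPositive a → t n p a ≡ bot n p
  t-NonPositive a∉P = trans (cong (mult n p (suc n)) (pow-bot a∉P)) (mult-bot (suc n))

  Positive⇔t≡top : ∀ {a} → InA n p a → Positive a ⇔ (t n p a ≡ top n p)
  Positive⇔t≡top {a} a∈A = mk⇔ t-Positive from
    where
    from : t n p a ≡ top n p → Positive a
    from t≡top with InA-split a∈A
    ... | inj₁ a∈P = a∈P
    ... | inj₂ a∉P with trans (sym (t-NonPositive a∉P)) t≡top
    ...   | ()

  IsImplFilter-pow : ∀ {G} → IsImplFilter n p G → ∀ {a} → G a → ∀ k → G (pow n p a k)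
  IsImplFilter-pow (_ , G-top , _ , _) _ zero = G-top
  IsImplFilter-pow G-filter@(_ , _ , G-mul , _) {a} a∈G (suc k) =
    G-mul a _ a∈G (IsImplFilter-pow G-filter a∈G k)

  bot-least : ∀ {b} → InA n p b → Leq n p (bot n p) b
  bot-least {_ , zero} b∈A = inj₂ (inj₁ (refl , refl , proj₂ (InA⇒Lω b∈A)))
  bot-least {_ , suc _} b∈A =
    inj₂ (inj₂ (refl , s≤s z≤n , ≼-trans predN≼N (x≼x+y N (proj₁ (InA⇒Lω b∈A)))))

  Positive-isImplFilter : IsImplFilter n p Positive
  Positive-isImplFilter =
    (λ _ → Positive⇒InA) , top-Positive , (λ _ _ → Positive-mul) ,
    (λ _ _ b∈A a∈P → Positive-upward a∈P b∈A)

  Positive-isProper : IsProper n p Positive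
  Positive-isProper A⊆P = bot-not-Positive (A⊆P (bot n p) bot∈A)

  -- A filter containing an element outside the cone contains its power ⊥, hence all of A.
  proper-filter⊆Positive : ∀ {G} → IsImplFilter n p G → IsProper n p G → ∀ {a} → G a → Positive a
  proper-filter⊆Positive {G} G-filter@(G⊆A , _ , _ , G-upward) G-proper {a} a∈G with InA-split (G⊆A a a∈G)
  ... | inj₁ a∈P = a∈P
  ... | inj₂ a∉P = ⊥-elim (G-proper λ b b∈A → G-upward (bot n p) b b∈A bot∈G (bot-least b∈A))
    where
    bot∈G : G (bot n p)
    bot∈G = subst G (pow-bot a∉P) (IsImplFilter-pow G-filter a∈G (suc n ⊔ p))

  Positive-isMaximal : IsMaximalFilter n p Positive
  Positive-isMaximal =
    Positive-isImplFilter , Positive-isProper ,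
    λ G G-filter G-proper _ a a∈G → proper-filter⊆Positive G-filter G-proper a∈G

  InRad⇔Positive : ∀ {a} → InRad n p a ⇔ Positive a
  InRad⇔Positive = mk⇔ (λ a∈Rad → a∈Rad Positive Positive-isMaximal)
    λ a∈P F (F-filter , F-proper , F-maximal) →
      F-maximal Positive Positive-isImplFilter Positive-isProper
        (λ _ → proper-filter⊆Positive F-filter F-proper) _ a∈P

-- Joins

  IsJoin-comm : ∀ {a b j} → IsJoin n p a b j → IsJoin n p b a j
  IsJoin-comm (j∈A , a≤j , b≤j , least) = j∈A , b≤j , a≤j , λ z z∈A b≤z a≤z → least z z∈A a≤z b≤z

  join-top-bot : IsJoin n p (top n p) (bot n p) (top n p)
  join-top-bot =
    Positive⇒InA top-Positive , inj₁ (s≤s z≤n , ℕP.≤-refl , ≼-refl N) , bot-least (Positive⇒InA top-Positive) ,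
    λ _ _ top≤z _ → top≤z

  join-Positive-zero : ∀ {x y} → Lω (+ n) x → Lω (+ n) y → IsJoin n p (x , p) (y , 0) (maxZ x (predN -Z y) , p)
  join-Positive-zero {x} {y} (0≼x , x≼N) (0≼y , _) =
    Positive⇒InA (_ , refl , ≼-trans 0≼x (maxZ-≼ˡ x (predN -Z y)) , maxZ-least x≼N predN-y≼N) ,
    inj₁ (s≤s z≤n , ℕP.≤-refl , maxZ-≼ˡ x (predN -Z y)) ,
    inj₂ (inj₂ (refl , s≤s z≤n ,
      subst (_≼ (y +Z maxZ x (predN -Z y))) (x+[y-x]≡y y predN) (+Z-monoʳ-≼ y (maxZ-≼ʳ x (predN -Z y))))) ,
    least
    where
    predN-y≼N : (predN -Z y) ≼ N
    predN-y≼N = ≼-trans (-Z-mono-≼ (≼-refl predN) 0≼y) (≼-trans (≼-reflexive (x+zeroZ≡x predN)) predN≼N)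
    least : ∀ z → InA n p z → Leq n p (x , p) z → Leq n p (y , 0) z → Leq n p (maxZ x (predN -Z y) , p) z
    least (w , _) _ (inj₁ (_ , p≤β , x≼w)) (inj₂ (inj₂ (_ , _ , predN≼y+w))) =
      inj₁ (s≤s z≤n , p≤β , maxZ-least x≼w (z≼x+y⇒z-x≼y y w predN≼y+w))
    least (_ , .0) _ (inj₁ (_ , () , _)) (inj₂ (inj₁ (_ , refl , _)))
    least _ _ (inj₂ (inj₁ (() , _))) _
    least _ _ (inj₂ (inj₂ (() , _))) _

  join-Positive-mid : ∀ {x α w} → InA n p (x , suc α) → Lω (+ n) w →
    IsJoin n p (x , suc α) (w , p) (maxZ x w , p)
  join-Positive-mid {x} {α} {w} a∈A (0≼w , w≼N) =
    Positive⇒InA (_ , refl , ≼-trans 0≼w (maxZ-≼ʳ x w) , maxZ-least (proj₂ (InA⇒Lω a∈A)) w≼N) ,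
    inj₁ (s≤s z≤n , InA⇒label≤p a∈A , maxZ-≼ˡ x w) ,
    inj₁ (s≤s z≤n , ℕP.≤-refl , maxZ-≼ʳ x w) ,
    least
    where
    least : ∀ z → InA n p z → Leq n p (x , suc α) z → Leq n p (w , p) z → Leq n p (maxZ x w , p) z
    least _ _ (inj₁ (_ , _ , x≼z)) (inj₁ (_ , p≤β , w≼z)) = inj₁ (s≤s z≤n , p≤β , maxZ-least x≼z w≼z)
    least _ _ (inj₁ _) (inj₂ (inj₁ (() , _)))
    least _ _ (inj₁ _) (inj₂ (inj₂ (() , _)))
    least _ _ (inj₂ (inj₁ (() , _))) _
    least _ _ (inj₂ (inj₂ (() , _))) _

  join-Positive-exists : ∀ {a b} → Positive a → InA n p b → Σ Raw (IsJoin n p a b)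
  join-Positive-exists {b = _ , zero} (_ , refl , x∈L) b∈A = _ , join-Positive-zero x∈L (InA⇒Lω b∈A)
  join-Positive-exists {b = _ , suc _} (_ , refl , x∈L) b∈A = _ , IsJoin-comm (join-Positive-mid b∈A x∈L)

  join-Positive : ∀ {a b j} → IsJoin n p a b j → Positive a → Positive j
  join-Positive (j∈A , a≤j , _) a∈P = Positive-upward a∈P j∈A a≤j

  neg-pow-split : ∀ {a} → InA n p a →
    InA n p (neg n p (pow n p a p)) × (Positive a ⊎ Positive (neg n p (pow n p a p)))
  neg-pow-split a∈A with InA-split a∈A
  ... | inj₂ a∉P = Positive⇒InA (neg-pow-Positive a∉P) , inj₂ (neg-pow-Positive a∉P)
  ... | inj₁ a∈P with Positive-pow a∈P p
  ...   | y , pow≡ , y∈L =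
    subst (InA n p) (sym (trans (cong (neg n p) pow≡) (neg-label-p y))) (inj₁ (inj₁ refl , y∈L)) , inj₁ a∈P

  t-Boolean : ∀ {a} → InA n p a → IsJoin n p (t n p a) (neg n p (t n p a)) (top n p)
  t-Boolean a∈A with InA-split a∈A
  ... | inj₁ a∈P = subst (λ c → IsJoin n p c (neg n p c) (top n p)) (sym (t-Positive a∈P))
                     (subst (λ c → IsJoin n p (top n p) c (top n p)) (sym (neg-label-p N)) join-top-bot)
  ... | inj₂ a∉P = subst (λ c → IsJoin n p c (neg n p c) (top n p)) (sym (t-NonPositive a∉P))
                     (IsJoin-comm join-top-bot)

  radical : ∀ {a} → InA n p a →
    (InRad n p a ⇔ (t n p a ≡ top n p))
    × ((t n p a ≡ top n p) ⇔ ((k : ℕ) → 0 < k → mult n p (suc n) (pow n p a k) ≡ top n p))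
  radical a∈A =
    Positive⇔t≡top a∈A ⇔-∘ InRad⇔Positive ,
    mk⇔ (λ t≡top k _ → mult-pow-Positive (Equivalence.from (Positive⇔t≡top a∈A) t≡top) k)
        (λ all-k → all-k (suc n ⊔ p) (ℕP.≤-trans (s≤s z≤n) (ℕP.m≤m⊔n (suc n) p)))

  join-neg-pow : ∀ k {a} → InA n p a →
    Σ Raw (IsJoin n p a (neg n p (pow n p a p)))
    × ((j : Raw) → IsJoin n p a (neg n p (pow n p a p)) j → mult n p (suc n) (pow n p j k) ≡ top n p)
  join-neg-pow k a∈A with neg-pow-split a∈A
  ... | b∈A , inj₁ a∈P =
    join-Positive-exists a∈P b∈A , λ _ a∨b → mult-pow-Positive (join-Positive a∨b a∈P) k
  ... | _ , inj₂ b∈P =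
    (_ , IsJoin-comm (proj₂ (join-Positive-exists b∈P a∈A))) ,
    λ _ a∨b → mult-pow-Positive (join-Positive (IsJoin-comm a∨b) b∈P) k

theorem3p6 : (n p : ℕ) → 0 < n → 0 < p →
    ((a : Raw) → InA n p a → IsJoin n p (t n p a) (neg n p (t n p a)) (top n p))
    × ((a : Raw) → InA n p a →
         (InRad n p a ⇔ (t n p a ≡ top n p))
         × ((t n p a ≡ top n p) ⇔ ((k : ℕ) → 0 < k → mult n p (suc n) (pow n p a k) ≡ top n p)))
    × ((k : ℕ) → 0 < k → (a : Raw) → InA n p a →
         Σ Raw (λ j → IsJoin n p a (neg n p (pow n p a p)) j)
         × ((j : Raw) → IsJoin n p a (neg n p (pow n p a p)) j →
              mult n p (suc n) (pow n p j k) ≡ top n p))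
theorem3p6 n (suc p') _ _ =
  (λ _ → t-Boolean n p') , (λ _ → radical n p') , (λ k _ _ → join-neg-pow n p' k)
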